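{- Let $P$ be a set of $n$ points partitioned into groups $\mathbf{g}_1,\dots,\mathbf{g}_k$ and let $h$ be a hashmap with $m$ buckets satisfying $\gamma$-discrepancy. Then the collision probability satisfies $Cp\le\frac{1+\gamma}{m}$, and for every group $\mathbf{g}_i$ the single-fairness probability satisfies $\frac{1-\gamma}{m}\le Sp_i\le\frac{1+\gamma}{m}$ and the pairwise collision probability satisfies $Pr_i\le\frac{1+\gamma}{m}$.
   Context: With $n_j$ the number of points of $P$ in bucket $j$ and $\alpha_{i,j}$ the number of points of $\mathbf{g}_i$ in bucket $j$: $Cp=\sum_j(n_j/n)^2$, $Sp_i=\sum_j\frac{\alpha_{i,j}}{|\mathbf{g}_i|}\frac{n_j}{n}$, $Pr_i=\sum_j(\alpha_{i,j}/|\mathbf{g}_i|)^2$. The hashmap satisfies $\gamma$-discrepancy if $(1-\gamma)\frac{|\mathbf{g}_i|}{m}\le\alpha_{i,j}\le(1+\gamma)\frac{|\mathbf{g}_i|}{m}$ for every group $i$ and every bucket $j$.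
   Formalization: The discrepancy parameter γ ranges over the rationals. -}

module Defs where

open import Data.Nat using (ℕ; zero; suc)
open import Data.Integer using (+_)
open import Data.Fin using (Fin; zero; suc; _≟_)
open import Data.Bool using (Bool; true; false; _∧_)
open import Data.Rational using (ℚ; 0ℚ; _+_; _*_; _/_)
open import Relation.Nullary.Decidable using (⌊_⌋)

count : ∀ {n} → (Fin n → Bool) → ℕ
count {zero}  p = 0
count {suc n} p with p zero
... | true  = suc (count (λ x → p (suc x)))
... | false = count (λ x → p (suc x))

sumℚ : ∀ {m} → (Fin m → ℚ) → ℚ
sumℚ {zero}  f = 0ℚ
sumℚ {suc m} f = f zero + sumℚ (λ x → f (suc x))

-- a / b as a rational; the b = 0 case is a dummy value (never used
-- under the hypotheses of the statement, where all denominators are positive)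
ratio : ℕ → ℕ → ℚ
ratio a zero    = 0ℚ
ratio a (suc b) = (+ a) / suc b

-- Setting: points of P are Fin n, g : Fin n → Fin k assigns each point its
-- group (a partition of P into k groups), h : Fin n → Fin m is the hashmap.

groupSize : ∀ {n k} → (Fin n → Fin k) → Fin k → ℕ
groupSize g i = count (λ p → ⌊ g p ≟ i ⌋)

bucketLoad : ∀ {n m} → (Fin n → Fin m) → Fin m → ℕ
bucketLoad h j = count (λ p → ⌊ h p ≟ j ⌋)

alpha : ∀ {n k m} → (Fin n → Fin k) → (Fin n → Fin m) → Fin k → Fin m → ℕ
alpha g h i j = count (λ p → ⌊ g p ≟ i ⌋ ∧ ⌊ h p ≟ j ⌋)

Cp : ∀ {n m} → (Fin n → Fin m) → ℚ
Cp {n} h = sumℚ (λ j → ratio (bucketLoad h j) n * ratio (bucketLoad h j) n)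

Sp : ∀ {n k m} → (Fin n → Fin k) → (Fin n → Fin m) → Fin k → ℚ
Sp {n} g h i = sumℚ (λ j → ratio (alpha g h i j) (groupSize g i) * ratio (bucketLoad h j) n)

Pr : ∀ {n k m} → (Fin n → Fin k) → (Fin n → Fin m) → Fin k → ℚ
Pr g h i = sumℚ (λ j → ratio (alpha g h i j) (groupSize g i) * ratio (alpha g h i j) (groupSize g i))

{-# OPTIONS --safe #-}
-- Dividing the discrepancy bounds by |gᵢ| puts every weight αᵢⱼ/|gᵢ| in
-- [(1-γ)/m, (1+γ)/m], and summing the upper bounds over the groups gives
-- nⱼ/n ≤ (1+γ)/m. Now Spᵢ averages αᵢⱼ/|gᵢ| against the probability vector
-- (nⱼ/n)ⱼ, Prᵢ averages it against itself, and Cp averages nⱼ/n against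
-- itself; an average lies between the bounds of the averaged quantity.
module Submission where

open import Defs
open import Data.Nat using (ℕ; suc)
open import Data.Fin using (Fin)
open import Data.Product using (_×_)
open import Data.Rational using (ℚ; 0ℚ; 1ℚ; _+_; _-_; _*_; _≤_)

open import Algebra.Bundles using (CommutativeMonoid)
open import Data.Bool using (Bool; true; false; _∧_)
open import Data.Bool.Properties using (∧-comm)
open import Data.Fin using (zero; suc; _≟_)
open import Data.Integer using (+_)
import Data.Integer as ℤ
import Data.Integer.Properties as ℤ
open import Data.Nat using (zero; s≤s; z≤n)
import Data.Nat as ℕ
import Data.Nat.Properties as ℕ
open import Data.Product using (_,_; proj₁; proj₂)
open import Data.Rational using (toℚᵘ; fromℚᵘ; nonNegative)
open import Data.Rational.Properties
  using ( ≤-refl; ≤-trans; ≤-reflexive; module ≤-Reasoning; +-mono-≤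
        ; *-monoʳ-≤-nonNeg; nonNegative⁻¹; normalize-nonNeg
        ; +-identityˡ; +-identityʳ; *-identityˡ; *-identityʳ; *-zeroˡ; *-zeroʳ
        ; *-comm; *-assoc; *-distribˡ-+; +-0-commutativeMonoid; nonNeg*nonNeg⇒nonNeg; nonNeg+nonNeg⇒nonNeg
        ; /-cong; toℚᵘ-injective; toℚᵘ-fromℚᵘ; fromℚᵘ-cong; toℚᵘ-homo-+; toℚᵘ-homo-* )
open import Data.Rational.Unnormalised using (mkℚᵘ; *≡*)
import Data.Rational.Unnormalised as ℚᵘ
import Data.Rational.Unnormalised.Properties as ℚᵘ
open import Relation.Binary.PropositionalEquality
open import Relation.Nullary.Decidable using (⌊_⌋; ⌊⌋-map′)
import Data.Fin.Properties as Fin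

open import Algebra.Properties.CommutativeSemigroup
  (CommutativeMonoid.commutativeSemigroup +-0-commutativeMonoid) using (interchange)

-- ratio a (suc b) is definitionally fromℚᵘ (mkℚᵘ (+ a) b), so identities between
-- ratios are transported from unnormalised rationals, where no gcd is taken.
fromℚᵘ-homo-* : ∀ p q → fromℚᵘ (p ℚᵘ.* q) ≡ fromℚᵘ p * fromℚᵘ q
fromℚᵘ-homo-* p q = toℚᵘ-injective (begin
  toℚᵘ (fromℚᵘ (p ℚᵘ.* q))                    ≈⟨ toℚᵘ-fromℚᵘ (p ℚᵘ.* q) ⟩
  p ℚᵘ.* q                                    ≈⟨ ℚᵘ.*-cong (toℚᵘ-fromℚᵘ p) (toℚᵘ-fromℚᵘ q) ⟨
  toℚᵘ (fromℚᵘ p) ℚᵘ.* toℚᵘ (fromℚᵘ q)         ≈⟨ toℚᵘ-homo-* (fromℚᵘ p) (fromℚᵘ q) ⟨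
  toℚᵘ (fromℚᵘ p * fromℚᵘ q)                  ∎)
  where open ℚᵘ.≃-Reasoning

fromℚᵘ-homo-+ : ∀ p q → fromℚᵘ (p ℚᵘ.+ q) ≡ fromℚᵘ p + fromℚᵘ q
fromℚᵘ-homo-+ p q = toℚᵘ-injective (begin
  toℚᵘ (fromℚᵘ (p ℚᵘ.+ q))                    ≈⟨ toℚᵘ-fromℚᵘ (p ℚᵘ.+ q) ⟩
  p ℚᵘ.+ q                                    ≈⟨ ℚᵘ.+-cong (toℚᵘ-fromℚᵘ p) (toℚᵘ-fromℚᵘ q) ⟨
  toℚᵘ (fromℚᵘ p) ℚᵘ.+ toℚᵘ (fromℚᵘ q)         ≈⟨ toℚᵘ-homo-+ (fromℚᵘ p) (fromℚᵘ q) ⟨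
  toℚᵘ (fromℚᵘ p + fromℚᵘ q)                  ∎)
  where open ℚᵘ.≃-Reasoning

ratio-+ : ∀ a c → ratio a 1 + ratio c 1 ≡ ratio (a ℕ.+ c) 1
ratio-+ a c = begin
  ratio a 1 + ratio c 1                       ≡⟨ fromℚᵘ-homo-+ (mkℚᵘ (+ a) 0) (mkℚᵘ (+ c) 0) ⟨
  fromℚᵘ (mkℚᵘ (+ a) 0 ℚᵘ.+ mkℚᵘ (+ c) 0)     ≡⟨ /-cong numerator refl ⟩
  ratio (a ℕ.+ c) 1                           ∎
  where
  open ≡-Reasoning
  numerator : + a ℤ.* + 1 ℤ.+ + c ℤ.* + 1 ≡ + (a ℕ.+ c)
  numerator = trans (cong₂ ℤ._+_ (ℤ.*-identityʳ (+ a)) (ℤ.*-identityʳ (+ c))) (sym (ℤ.pos-+ a c))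

ratio-* : ∀ a c b → ratio a 1 * ratio c (suc b) ≡ ratio (a ℕ.* c) (suc b)
ratio-* a c b = begin
  ratio a 1 * ratio c (suc b)                 ≡⟨ fromℚᵘ-homo-* (mkℚᵘ (+ a) 0) (mkℚᵘ (+ c) b) ⟨
  fromℚᵘ (mkℚᵘ (+ a) 0 ℚᵘ.* mkℚᵘ (+ c) b)     ≡⟨ /-cong (sym (ℤ.pos-* a c)) (ℕ.*-identityˡ (suc b)) ⟩
  ratio (a ℕ.* c) (suc b)                     ∎
  where open ≡-Reasoning

ratio-self : ∀ b → ratio (suc b) (suc b) ≡ 1ℚ
ratio-self b = fromℚᵘ-cong {mkℚᵘ (+ suc b) b} {ℚᵘ.1ℚᵘ} (*≡* (ℤ.*-comm (+ suc b) (+ 1)))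

ratio-split : ∀ a b → ratio a (suc b) ≡ ratio a 1 * ratio 1 (suc b)
ratio-split a b = trans (cong (λ x → ratio x (suc b)) (sym (ℕ.*-identityʳ a))) (sym (ratio-* a 1 b))

ratio-inverse : ∀ b → ratio (suc b) 1 * ratio 1 (suc b) ≡ 1ℚ
ratio-inverse b = trans (sym (ratio-split (suc b) b)) (ratio-self b)

ratio-nonNeg : ∀ a b → 0ℚ ≤ ratio a b
ratio-nonNeg a zero    = ≤-refl
ratio-nonNeg a (suc b) = nonNegative⁻¹ _ {{normalize-nonNeg a (suc b)}}

*-ratio-split : ∀ c a {m} → 1 ℕ.≤ m → c * ratio a m ≡ (c * ratio 1 m) * ratio a 1
*-ratio-split c a {suc m} _ = begin
  c * ratio a (suc m)                   ≡⟨ cong (c *_) (ratio-split a m) ⟩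
  c * (ratio a 1 * ratio 1 (suc m))     ≡⟨ cong (c *_) (*-comm (ratio a 1) _) ⟩
  c * (ratio 1 (suc m) * ratio a 1)     ≡⟨ *-assoc c _ _ ⟨
  (c * ratio 1 (suc m)) * ratio a 1     ∎
  where open ≡-Reasoning

*-ratio-cancel : ∀ y b → (y * ratio (suc b) 1) * ratio 1 (suc b) ≡ y
*-ratio-cancel y b = trans (*-assoc y _ _) (trans (cong (y *_) (ratio-inverse b)) (*-identityʳ y))

ratio-≤-÷ : ∀ {a b} {y : ℚ} → 1 ℕ.≤ b → ratio a 1 ≤ y * ratio b 1 → ratio a b ≤ y
ratio-≤-÷ {a} {suc b} {y} _ a≤yb = begin
  ratio a (suc b)                           ≡⟨ ratio-split a b ⟩
  ratio a 1 * ratio 1 (suc b)               ≤⟨ *-monoʳ-≤-nonNeg _ {{nonNegative (ratio-nonNeg 1 (suc b))}} a≤yb ⟩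
  (y * ratio (suc b) 1) * ratio 1 (suc b)   ≡⟨ *-ratio-cancel y b ⟩
  y                                         ∎
  where open ≤-Reasoning

ratio-≥-÷ : ∀ {a b} {y : ℚ} → 1 ℕ.≤ b → y * ratio b 1 ≤ ratio a 1 → y ≤ ratio a b
ratio-≥-÷ {a} {suc b} {y} _ yb≤a = begin
  y                                         ≡⟨ *-ratio-cancel y b ⟨
  (y * ratio (suc b) 1) * ratio 1 (suc b)   ≤⟨ *-monoʳ-≤-nonNeg _ {{nonNegative (ratio-nonNeg 1 (suc b))}} yb≤a ⟩
  ratio a 1 * ratio 1 (suc b)               ≡⟨ ratio-split a b ⟨
  ratio a (suc b)                           ∎
  where open ≤-Reasoning

ratio-≤-rescale : ∀ {a G m} (c : ℚ) → 1 ℕ.≤ m → 1 ℕ.≤ G →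
                  ratio a 1 ≤ c * ratio G m → ratio a G ≤ c * ratio 1 m
ratio-≤-rescale {a} {G} c m≥1 G≥1 a≤cG/m =
  ratio-≤-÷ G≥1 (≤-trans a≤cG/m (≤-reflexive (*-ratio-split c G m≥1)))

ratio-≥-rescale : ∀ {a G m} (c : ℚ) → 1 ℕ.≤ m → 1 ℕ.≤ G →
                  c * ratio G m ≤ ratio a 1 → c * ratio 1 m ≤ ratio a G
ratio-≥-rescale {a} {G} c m≥1 G≥1 cG/m≤a =
  ratio-≥-÷ G≥1 (≤-trans (≤-reflexive (sym (*-ratio-split c G m≥1))) cG/m≤a)

sumℚ-cong : ∀ {m} {f g : Fin m → ℚ} → (∀ j → f j ≡ g j) → sumℚ f ≡ sumℚ g
sumℚ-cong {zero}  f≡g = refl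
sumℚ-cong {suc m} f≡g = cong₂ _+_ (f≡g zero) (sumℚ-cong (λ j → f≡g (suc j)))

sumℚ-mono-≤ : ∀ {m} {f g : Fin m → ℚ} → (∀ j → f j ≤ g j) → sumℚ f ≤ sumℚ g
sumℚ-mono-≤ {zero}  f≤g = ≤-refl
sumℚ-mono-≤ {suc m} f≤g = +-mono-≤ (f≤g zero) (sumℚ-mono-≤ (λ j → f≤g (suc j)))

sumℚ-zero : ∀ m → sumℚ {m} (λ _ → 0ℚ) ≡ 0ℚ
sumℚ-zero zero    = refl
sumℚ-zero (suc m) = trans (+-identityˡ _) (sumℚ-zero m)

sumℚ-*ˡ : ∀ {m} c (f : Fin m → ℚ) → sumℚ (λ j → c * f j) ≡ c * sumℚ f
sumℚ-*ˡ {zero}  c f = sym (*-zeroʳ c)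
sumℚ-*ˡ {suc m} c f = trans (cong (_+_ (c * f zero)) (sumℚ-*ˡ c (λ j → f (suc j)))) (sym (*-distribˡ-+ c _ _))

sumℚ-*ʳ : ∀ {m} c (f : Fin m → ℚ) → sumℚ (λ j → f j * c) ≡ sumℚ f * c
sumℚ-*ʳ c f = trans (sumℚ-cong (λ j → *-comm (f j) c)) (trans (sumℚ-*ˡ c f) (*-comm c _))

sumℚ-+ : ∀ {m} (f g : Fin m → ℚ) → sumℚ (λ j → f j + g j) ≡ sumℚ f + sumℚ g
sumℚ-+ {zero}  f g = refl
sumℚ-+ {suc m} f g =
  trans (cong (_+_ (f zero + g zero)) (sumℚ-+ (λ j → f (suc j)) (λ j → g (suc j))))
        (interchange (f zero) (g zero) _ _)

sumℚ-comm : ∀ {k m} (f : Fin k → Fin m → ℚ) →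
            sumℚ (λ j → sumℚ (λ i → f i j)) ≡ sumℚ (λ i → sumℚ (λ j → f i j))
sumℚ-comm {zero}  {m} f = sumℚ-zero m
sumℚ-comm {suc k}     f =
  trans (sumℚ-+ (f zero) (λ j → sumℚ (λ i → f (suc i) j)))
        (cong (_+_ (sumℚ (f zero))) (sumℚ-comm (λ i → f (suc i))))

weightedMean-≤ : ∀ {m} {c : ℚ} (a w : Fin m → ℚ) → (∀ j → 0ℚ ≤ w j) → sumℚ w ≡ 1ℚ →
                 (∀ j → a j ≤ c) → sumℚ (λ j → a j * w j) ≤ c
weightedMean-≤ {c = c} a w w≥0 Σw≡1 a≤c = begin
  sumℚ (λ j → a j * w j)  ≤⟨ sumℚ-mono-≤ (λ j → *-monoʳ-≤-nonNeg (w j) {{nonNegative (w≥0 j)}} (a≤c j)) ⟩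
  sumℚ (λ j → c * w j)    ≡⟨ sumℚ-*ˡ c w ⟩
  c * sumℚ w              ≡⟨ cong (c *_) Σw≡1 ⟩
  c * 1ℚ                  ≡⟨ *-identityʳ c ⟩
  c                       ∎
  where open ≤-Reasoning

weightedMean-≥ : ∀ {m} {c : ℚ} (a w : Fin m → ℚ) → (∀ j → 0ℚ ≤ w j) → sumℚ w ≡ 1ℚ →
                 (∀ j → c ≤ a j) → c ≤ sumℚ (λ j → a j * w j)
weightedMean-≥ {c = c} a w w≥0 Σw≡1 c≤a = begin
  c                       ≡⟨ *-identityʳ c ⟨
  c * 1ℚ                  ≡⟨ cong (c *_) Σw≡1 ⟨
  c * sumℚ w              ≡⟨ sumℚ-*ˡ c w ⟨
  sumℚ (λ j → c * w j)    ≤⟨ sumℚ-mono-≤ (λ j → *-monoʳ-≤-nonNeg (w j) {{nonNegative (w≥0 j)}} (c≤a j)) ⟩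
  sumℚ (λ j → a j * w j)  ∎
  where open ≤-Reasoning

indicator : Bool → ℚ
indicator true  = 1ℚ
indicator false = 0ℚ

indicator-∧ : ∀ a b → indicator (a ∧ b) ≡ indicator a * indicator b
indicator-∧ true  b = sym (*-identityˡ (indicator b))
indicator-∧ false b = sym (*-zeroˡ (indicator b))

sumℚ-indicator-≟ : ∀ {m} (y : Fin m) → sumℚ (λ j → indicator ⌊ y ≟ j ⌋) ≡ 1ℚ
sumℚ-indicator-≟ {suc m} zero    = trans (cong (_+_ 1ℚ) (sumℚ-zero m)) (+-identityʳ 1ℚ)
sumℚ-indicator-≟ {suc m} (suc y) = trans (+-identityˡ _) (trans
  (sumℚ-cong (λ j → cong indicator (⌊⌋-map′ (cong suc) Fin.suc-injective (y ≟ j))))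
  (sumℚ-indicator-≟ y))

count-as-sum : ∀ {n} (p : Fin n → Bool) → ratio (count p) 1 ≡ sumℚ (λ x → indicator (p x))
count-as-sum {zero}  p = refl
count-as-sum {suc n} p with p zero
... | true  = trans (sym (ratio-+ 1 (count (λ x → p (suc x))))) (cong (_+_ 1ℚ) (count-as-sum (λ x → p (suc x))))
... | false = trans (count-as-sum (λ x → p (suc x))) (sym (+-identityˡ _))

count-cong : ∀ {n} {p q : Fin n → Bool} → (∀ x → p x ≡ q x) → count p ≡ count q
count-cong {zero}          _   = refl
count-cong {suc n} {p} {q} p≡q with p zero | q zero | p≡q zero
... | true  | true  | refl = cong suc (count-cong (λ x → p≡q (suc x)))
... | false | false | refl = count-cong (λ x → p≡q (suc x))

count-true : ∀ n → count {n} (λ _ → true) ≡ n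
count-true zero    = refl
count-true (suc n) = cong suc (count-true n)

count-fibres : ∀ {n m} (p : Fin n → Bool) (f : Fin n → Fin m) →
               sumℚ (λ j → ratio (count (λ x → p x ∧ ⌊ f x ≟ j ⌋)) 1) ≡ ratio (count p) 1
count-fibres p f = begin
  sumℚ (λ j → ratio (count (λ x → p x ∧ ⌊ f x ≟ j ⌋)) 1)
    ≡⟨ sumℚ-cong (λ j → count-as-sum (λ x → p x ∧ ⌊ f x ≟ j ⌋)) ⟩
  sumℚ (λ j → sumℚ (λ x → indicator (p x ∧ ⌊ f x ≟ j ⌋)))
    ≡⟨ sumℚ-comm (λ x j → indicator (p x ∧ ⌊ f x ≟ j ⌋)) ⟩
  sumℚ (λ x → sumℚ (λ j → indicator (p x ∧ ⌊ f x ≟ j ⌋)))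
    ≡⟨ sumℚ-cong fibre ⟩
  sumℚ (λ x → indicator (p x))
    ≡⟨ count-as-sum p ⟨
  ratio (count p) 1 ∎
  where
  open ≡-Reasoning
  fibre : ∀ x → sumℚ (λ j → indicator (p x ∧ ⌊ f x ≟ j ⌋)) ≡ indicator (p x)
  fibre x = begin
    sumℚ (λ j → indicator (p x ∧ ⌊ f x ≟ j ⌋))       ≡⟨ sumℚ-cong (λ j → indicator-∧ (p x) ⌊ f x ≟ j ⌋) ⟩
    sumℚ (λ j → indicator (p x) * indicator ⌊ f x ≟ j ⌋) ≡⟨ sumℚ-*ˡ (indicator (p x)) (λ j → indicator ⌊ f x ≟ j ⌋) ⟩
    indicator (p x) * sumℚ (λ j → indicator ⌊ f x ≟ j ⌋) ≡⟨ cong (indicator (p x) *_) (sumℚ-indicator-≟ (f x)) ⟩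
    indicator (p x) * 1ℚ                               ≡⟨ *-identityʳ _ ⟩
    indicator (p x)                                    ∎

count-pos⇒pos : ∀ {n} (p : Fin n → Bool) → 1 ℕ.≤ count p → 1 ℕ.≤ n
count-pos⇒pos {zero}  p ()
count-pos⇒pos {suc n} p _ = s≤s z≤n

sumℚ-ratio-normalise : ∀ {m N} (a : Fin m → ℕ) → 1 ℕ.≤ N →
                       sumℚ (λ j → ratio (a j) 1) ≡ ratio N 1 → sumℚ (λ j → ratio (a j) N) ≡ 1ℚ
sumℚ-ratio-normalise {N = suc N} a _ Σa≡N = begin
  sumℚ (λ j → ratio (a j) (suc N))                  ≡⟨ sumℚ-cong (λ j → ratio-split (a j) N) ⟩
  sumℚ (λ j → ratio (a j) 1 * ratio 1 (suc N))      ≡⟨ sumℚ-*ʳ (ratio 1 (suc N)) (λ j → ratio (a j) 1) ⟩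
  sumℚ (λ j → ratio (a j) 1) * ratio 1 (suc N)      ≡⟨ cong (_* ratio 1 (suc N)) Σa≡N ⟩
  ratio (suc N) 1 * ratio 1 (suc N)                 ≡⟨ ratio-inverse N ⟩
  1ℚ                                                ∎
  where open ≡-Reasoning

bucketLoad-sum : ∀ {n m} (h : Fin n → Fin m) → sumℚ (λ j → ratio (bucketLoad h j) 1) ≡ ratio n 1
bucketLoad-sum {n} h = trans (count-fibres (λ _ → true) h) (cong (λ c → ratio c 1) (count-true n))

groupSize-sum : ∀ {n k} (g : Fin n → Fin k) → sumℚ (λ i → ratio (groupSize g i) 1) ≡ ratio n 1
groupSize-sum = bucketLoad-sum

alpha-sum-buckets : ∀ {n k m} (g : Fin n → Fin k) (h : Fin n → Fin m) i →
                    sumℚ (λ j → ratio (alpha g h i j) 1) ≡ ratio (groupSize g i) 1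
alpha-sum-buckets g h i = count-fibres (λ x → ⌊ g x ≟ i ⌋) h

alpha-sum-groups : ∀ {n k m} (g : Fin n → Fin k) (h : Fin n → Fin m) j →
                   sumℚ (λ i → ratio (alpha g h i j) 1) ≡ ratio (bucketLoad h j) 1
alpha-sum-groups g h j = trans
  (sumℚ-cong (λ i → cong (λ c → ratio c 1) (count-cong (λ x → ∧-comm ⌊ g x ≟ i ⌋ ⌊ h x ≟ j ⌋))))
  (count-fibres (λ x → ⌊ h x ≟ j ⌋) g)

bucketLoad-upper : ∀ {n k m} (g : Fin n → Fin k) (h : Fin n → Fin m) (c : ℚ) → 1 ℕ.≤ m →
                   (∀ i j → ratio (alpha g h i j) 1 ≤ c * ratio (groupSize g i) m) →
                   ∀ j → ratio (bucketLoad h j) 1 ≤ (c * ratio 1 m) * ratio n 1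
bucketLoad-upper {n} {m = m} g h c m≥1 α≤ j = begin
  ratio (bucketLoad h j) 1                               ≡⟨ alpha-sum-groups g h j ⟨
  sumℚ (λ i → ratio (alpha g h i j) 1)                   ≤⟨ sumℚ-mono-≤ (λ i → ≤-trans (α≤ i j) (≤-reflexive (*-ratio-split c (groupSize g i) m≥1))) ⟩
  sumℚ (λ i → (c * ratio 1 m) * ratio (groupSize g i) 1) ≡⟨ sumℚ-*ˡ (c * ratio 1 m) (λ i → ratio (groupSize g i) 1) ⟩
  (c * ratio 1 m) * sumℚ (λ i → ratio (groupSize g i) 1) ≡⟨ cong ((c * ratio 1 m) *_) (groupSize-sum g) ⟩
  (c * ratio 1 m) * ratio n 1                            ∎
  where open ≤-Reasoning

Cp-upper : ∀ {n k m} (g : Fin n → Fin k) (h : Fin n → Fin m) (c : ℚ) → 1 ℕ.≤ m → 0ℚ ≤ c →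
           (∀ i j → ratio (alpha g h i j) 1 ≤ c * ratio (groupSize g i) m) → Cp h ≤ c * ratio 1 m
-- With no points every nⱼ/n is the junk value ratio _ 0 = 0ℚ, so Cp h vanishes.
Cp-upper {zero} {m = m} _ _ c _ c≥0 _ = begin
  sumℚ {m} (λ _ → 0ℚ * 0ℚ)   ≡⟨ sumℚ-cong {m} (λ _ → *-zeroˡ 0ℚ) ⟩
  sumℚ {m} (λ _ → 0ℚ)        ≡⟨ sumℚ-zero m ⟩
  0ℚ                         ≤⟨ nonNegative⁻¹ _ {{nonNeg*nonNeg⇒nonNeg c {{nonNegative c≥0}} (ratio 1 m) {{nonNegative (ratio-nonNeg 1 m)}}}} ⟩
  c * ratio 1 m              ∎
  where open ≤-Reasoning
Cp-upper {suc n} {m = m} g h c m≥1 c≥0 α≤ =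
  weightedMean-≤ load load (λ j → ratio-nonNeg (bucketLoad h j) (suc n)) Σload≡1 load≤
  where
  load : Fin m → ℚ
  load j = ratio (bucketLoad h j) (suc n)
  load≤ : ∀ j → load j ≤ c * ratio 1 m
  load≤ j = ratio-≤-÷ {bucketLoad h j} (s≤s z≤n) (bucketLoad-upper g h c m≥1 α≤ j)
  Σload≡1 : sumℚ load ≡ 1ℚ
  Σload≡1 = sumℚ-ratio-normalise (bucketLoad h) (s≤s z≤n) (bucketLoad-sum h)

module _ {n k m : ℕ} (g : Fin n → Fin k) (h : Fin n → Fin m) (c : ℚ) (m≥1 : 1 ℕ.≤ m)
         (i : Fin k) (|gᵢ|≥1 : 1 ℕ.≤ groupSize g i) where

  private
    weight : Fin m → ℚ
    weight j = ratio (alpha g h i j) (groupSize g i)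

    load : Fin m → ℚ
    load j = ratio (bucketLoad h j) n

    weight≥0 : ∀ j → 0ℚ ≤ weight j
    weight≥0 j = ratio-nonNeg (alpha g h i j) (groupSize g i)

    load≥0 : ∀ j → 0ℚ ≤ load j
    load≥0 j = ratio-nonNeg (bucketLoad h j) n

    Σweight≡1 : sumℚ weight ≡ 1ℚ
    Σweight≡1 = sumℚ-ratio-normalise (alpha g h i) |gᵢ|≥1 (alpha-sum-buckets g h i)

    Σload≡1 : sumℚ load ≡ 1ℚ
    Σload≡1 = sumℚ-ratio-normalise (bucketLoad h) (count-pos⇒pos (λ x → ⌊ g x ≟ i ⌋) |gᵢ|≥1) (bucketLoad-sum h)

  Sp-lower : (∀ j → c * ratio (groupSize g i) m ≤ ratio (alpha g h i j) 1) → c * ratio 1 m ≤ Sp g h i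
  Sp-lower α≥ = weightedMean-≥ weight load load≥0 Σload≡1 (λ j → ratio-≥-rescale c m≥1 |gᵢ|≥1 (α≥ j))

  Sp-upper : (∀ j → ratio (alpha g h i j) 1 ≤ c * ratio (groupSize g i) m) → Sp g h i ≤ c * ratio 1 m
  Sp-upper α≤ = weightedMean-≤ weight load load≥0 Σload≡1 (λ j → ratio-≤-rescale c m≥1 |gᵢ|≥1 (α≤ j))

  Pr-upper : (∀ j → ratio (alpha g h i j) 1 ≤ c * ratio (groupSize g i) m) → Pr g h i ≤ c * ratio 1 m
  Pr-upper α≤ = weightedMean-≤ weight weight weight≥0 Σweight≡1 (λ j → ratio-≤-rescale c m≥1 |gᵢ|≥1 (α≤ j))

lemma5p1 : (n k m : ℕ) → 1 Data.Nat.≤ m → (g : Fin n → Fin k) → (h : Fin n → Fin m) → (γ : ℚ) → 0ℚ ≤ γ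
    → (∀ i → 1 Data.Nat.≤ groupSize g i)
    → (∀ i j → ((1ℚ - γ) * ratio (groupSize g i) m ≤ ratio (alpha g h i j) 1)
               × (ratio (alpha g h i j) 1 ≤ (1ℚ + γ) * ratio (groupSize g i) m))
    → (Cp h ≤ (1ℚ + γ) * ratio 1 m)
      × (∀ i → ((1ℚ - γ) * ratio 1 m ≤ Sp g h i)
               × (Sp g h i ≤ (1ℚ + γ) * ratio 1 m)
               × (Pr g h i ≤ (1ℚ + γ) * ratio 1 m))
lemma5p1 n k m m≥1 g h γ γ≥0 |g|≥1 discrepancy =
  Cp-upper g h (1ℚ + γ) m≥1 1+γ≥0 (λ i j → proj₂ (discrepancy i j)) ,
  λ i → Sp-lower g h (1ℚ - γ) m≥1 i (|g|≥1 i) (λ j → proj₁ (discrepancy i j))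
      , Sp-upper g h (1ℚ + γ) m≥1 i (|g|≥1 i) (λ j → proj₂ (discrepancy i j))
      , Pr-upper g h (1ℚ + γ) m≥1 i (|g|≥1 i) (λ j → proj₂ (discrepancy i j))
  where
  1+γ≥0 : 0ℚ ≤ 1ℚ + γ
  1+γ≥0 = nonNegative⁻¹ _ {{nonNeg+nonNeg⇒nonNeg 1ℚ γ {{nonNegative γ≥0}}}}
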